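{- Let $n\in\mathbb{N}$. The complete graph $K_n$ is an $\mathcal{N}$ position of Grim if and only if $n$ is even.
   Context: Grim: two players alternate moves on a finite simple undirected graph. Before play, isolated vertices are deleted. A move consists of choosing a remaining vertex and deleting it together with its incident edges, and then deleting every vertex that has become isolated. The player making the last move wins (a player with no available move loses). A graph is an $\mathcal{N}$ position if the player about to move has a winning strategy, and a $\mathcal{P}$ position otherwise. -}

module Defs where

open import Level using (0ℓ)
open import Data.Nat using (ℕ)
open import Data.Fin using (Fin)
open import Data.Product using (_×_; ∃)
open import Data.Unit using (⊤)
open import Relation.Nullary using (¬_)
open import Relation.Binary.PropositionalEquality using (_≡_; _≢_)

record Graph : Set₁ where
  field
    n      : ℕ
    Adj    : Fin n → Fin n → Set
    sym    : ∀ {u v} → Adj u v → Adj v u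
    irrefl : ∀ {v} → ¬ Adj v v

-- A set of remaining vertices (the position is the induced subgraph on it;
-- deleting vertices deletes exactly their incident edges, so every position
-- reached in Grim is an induced subgraph of the starting graph).
VSet : Graph → Set₁
VSet G = Fin (Graph.n G) → Set

module _ (G : Graph) where
  open Graph G

  removeIsolated : VSet G → VSet G
  removeIsolated S v = S v × ∃ λ u → S u × Adj u v

  move : VSet G → Fin n → VSet G
  move S v = removeIsolated (λ u → S u × u ≢ v)

  start : VSet G
  start = removeIsolated (λ _ → ⊤)

  -- normal play: the player making the last move wins.
  data WinPos : VSet G → Set₁
  data LosePos : VSet G → Set₁

  data WinPos where
    win : ∀ {S} (v : Fin n) → S v → LosePos (move S v) → WinPos S

  data LosePos where
    lose : ∀ {S} → (∀ (v : Fin n) → S v → WinPos (move S v)) → LosePos S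

IsN : Graph → Set₁
IsN G = WinPos G (start G)

IsP : Graph → Set₁
IsP G = ¬ IsN G

K : ℕ → Graph
K n = record
  { n = n
  ; Adj = λ u v → u ≢ v
  ; sym = λ u≢v v≡u → u≢v (Relation.Binary.PropositionalEquality.sym v≡u)
  ; irrefl = λ v≢v → v≢v Relation.Binary.PropositionalEquality.refl
  }

-- In K n every vertex set is a clique, so a position is determined by its
-- number m of vertices. A move turns m ≥ 3 vertices into m − 1, but 2 vertices
-- into none, because the survivor is isolated. Hence positions with 2 + 2j
-- vertices are won and those with 3 + 2j are lost. The starting position is
-- K n itself when n ≥ 2, and empty when n = 1.
module Submission where

open import Defs
open import Data.Nat using (ℕ; _≤_; _+_; _*_; suc; zero)
open import Data.Nat.Properties using (suc-injective)
open import Data.Nat.Divisibility using (_∣_; divides; n∣m⇒m%n≡0)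
open import Data.Nat.DivMod using (_divMod_; result; [m+kn]%n≡m%n)
open import Data.Fin using (Fin; _≟_)
open import Data.Fin.Patterns using (0F; 1F)
open import Data.List using (List; []; _∷_; length; allFin)
open import Data.List.Properties using (length-removeAt′; length-tabulate)
open import Data.List.Membership.Propositional using (_∈_)
open import Data.List.Membership.Propositional.Properties using (∈-allFin)
open import Data.List.Relation.Unary.Any using (here; there; index; _─_)
open import Data.List.Relation.Unary.Any.Properties using (¬Any[]; singleton⁻)
open import Data.List.Relation.Unary.All as All using ()
open import Data.List.Relation.Unary.AllPairs using ([]; _∷_)
open import Data.List.Relation.Unary.Unique.Propositional using (Unique)
open import Data.List.Relation.Unary.Unique.Propositional.Properties using (allFin⁺)
open import Data.Product using (_×_; _,_; proj₁; ∃; ∃-syntax)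
open import Data.Unit using (⊤; tt)
open import Data.Empty using (⊥-elim)
open import Function using (_∘_)
open import Function.Bundles using (_⇔_; mk⇔)
open import Relation.Nullary using (¬_; yes; no; contradiction)
open import Relation.Binary.PropositionalEquality using (_≡_; _≢_; refl; sym; trans)

module _ {a} {A : Set a} where

  ∈-─⁻ : ∀ {xs} {u v : A} (p : v ∈ xs) → u ∈ (xs ─ p) → u ∈ xs
  ∈-─⁻ (here _)  q         = there q
  ∈-─⁻ (there p) (here e)  = here e
  ∈-─⁻ (there p) (there q) = there (∈-─⁻ p q)

  ∈-─⁺ : ∀ {xs} {u v : A} (p : v ∈ xs) → u ∈ xs → u ≢ v → u ∈ (xs ─ p)
  ∈-─⁺ (here refl) (here refl) u≢v = ⊥-elim (u≢v refl)
  ∈-─⁺ (here _)    (there q)   _   = q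
  ∈-─⁺ (there p)   (here e)    _   = here e
  ∈-─⁺ (there p)   (there q)   u≢v = there (∈-─⁺ p q u≢v)

  ∈-─⇒≢ : ∀ {xs} {u v : A} → Unique xs → (p : v ∈ xs) → u ∈ (xs ─ p) → u ≢ v
  ∈-─⇒≢ (v∉ ∷ _)        (here refl) q           = λ u≡v → All.lookup v∉ q (sym u≡v)
  ∈-─⇒≢ (u∉ ∷ _)        (there p)   (here refl) = All.lookup u∉ p
  ∈-─⇒≢ (_  ∷ distinct) (there p)   (there q)   = ∈-─⇒≢ distinct p q

  Unique-─ : ∀ {xs} {v : A} → Unique xs → (p : v ∈ xs) → Unique (xs ─ p)
  Unique-─ (_  ∷ distinct) (here _)  = distinct
  Unique-─ (x∉ ∷ distinct) (there p) =
    All.tabulate (All.lookup x∉ ∘ ∈-─⁻ p) ∷ Unique-─ distinct p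

WinPos⇒¬LosePos : ∀ {G S} → WinPos G S → ¬ LosePos G S
WinPos⇒¬LosePos (win v sv lp) (lose f) = WinPos⇒¬LosePos (f v sv) lp

module _ {n : ℕ} where

  Position : Set₁
  Position = VSet (K n)

  record Enumerates (xs : List (Fin n)) (S : Position) : Set where
    field
      unique   : Unique xs
      complete : ∀ {v} → S v → v ∈ xs
      sound    : ∀ {v} → v ∈ xs → S v

  open Enumerates

  -- Positions are predicates, so their size is witnessed by a
  -- duplicate-free enumeration.
  _HasSize_ : Position → ℕ → Set
  S HasSize m = ∃[ xs ] Enumerates xs S × length xs ≡ m

  _without_ : Position → Fin n → Position
  (S without v) u = S u × u ≢ v

  everything-HasSize : (λ _ → ⊤) HasSize n
  everything-HasSize =
    allFin n ,
    record { unique = allFin⁺ n ; complete = λ _ → ∈-allFin _ ; sound = λ _ → tt } ,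
    length-tabulate _

  occupied : ∀ {S m} → S HasSize suc m → ∃ S
  occupied (x ∷ _ , e , _) = x , sound e (here refl)

  without-HasSize : ∀ {S m v} → S HasSize suc m → S v → (S without v) HasSize m
  without-HasSize {v = v} (xs , e , len) sv =
    (xs ─ p) ,
    record
      { unique   = Unique-─ (unique e) p
      ; complete = λ (su , u≢v) → ∈-─⁺ p (complete e su) u≢v
      ; sound    = λ q → sound e (∈-─⁻ p q) , ∈-─⇒≢ (unique e) p q
      } ,
    suc-injective (trans (sym (length-removeAt′ xs (index p))) len)
    where
    p : v ∈ xs
    p = complete e sv

  removeIsolated-HasSize₁ : ∀ {T} → T HasSize 1 → removeIsolated (K n) T HasSize 0
  removeIsolated-HasSize₁ {T} (x ∷ [] , e , refl) =
    [] , record { unique = [] ; complete = isolated ; sound = λ () } , refl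
    where
    isolated : ∀ {v} → removeIsolated (K n) T v → v ∈ []
    isolated (tv , u , tu , u≢v) =
      ⊥-elim (u≢v (trans (singleton⁻ (complete e tu)) (sym (singleton⁻ (complete e tv)))))

  removeIsolated-HasSize₂₊ : ∀ {T m} → T HasSize (2 + m) →
                             removeIsolated (K n) T HasSize (2 + m)
  removeIsolated-HasSize₂₊ {T} (x ∷ y ∷ xs , e , len) =
    x ∷ y ∷ xs ,
    record
      { unique   = unique e
      ; complete = complete e ∘ proj₁
      ; sound    = λ q → sound e q , neighbour q
      } ,
    len
    where
    x≢y : x ≢ y
    x≢y with unique e
    ... | x∉ ∷ _ = All.head x∉

    neighbour : ∀ {v} → v ∈ x ∷ y ∷ xs → ∃ λ u → T u × u ≢ v
    neighbour {v} q with v ≟ x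
    ... | yes refl = y , sound e (there (here refl)) , x≢y ∘ sym
    ... | no v≢x   = x , sound e (here refl) , v≢x ∘ sym

  move-HasSize₂ : ∀ {S v} → S HasSize 2 → S v → move (K n) S v HasSize 0
  move-HasSize₂ h sv = removeIsolated-HasSize₁ (without-HasSize h sv)

  move-HasSize₃₊ : ∀ {S m v} → S HasSize (3 + m) → S v →
                   move (K n) S v HasSize (2 + m)
  move-HasSize₃₊ h sv = removeIsolated-HasSize₂₊ (without-HasSize h sv)

  emptyLoses : ∀ {S} → S HasSize 0 → LosePos (K n) S
  emptyLoses ([] , e , _) = lose λ _ sv → ⊥-elim (¬Any[] (complete e sv))

  evenCliqueWins : ∀ {S} j → S HasSize (2 + j * 2) → WinPos (K n) S
  oddCliqueLoses : ∀ {S} j → S HasSize (3 + j * 2) → LosePos (K n) S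

  evenCliqueWins zero    h with occupied h
  ... | v , sv = win v sv (emptyLoses (move-HasSize₂ h sv))
  evenCliqueWins (suc j) h with occupied h
  ... | v , sv = win v sv (oddCliqueLoses j (move-HasSize₃₊ h sv))

  oddCliqueLoses j h = lose λ v sv → evenCliqueWins j (move-HasSize₃₊ h sv)

odd-start-loses : ∀ q → LosePos (K (1 + q * 2)) (start (K (1 + q * 2)))
odd-start-loses zero    = emptyLoses (removeIsolated-HasSize₁ everything-HasSize)
odd-start-loses (suc j) = oddCliqueLoses j (removeIsolated-HasSize₂₊ everything-HasSize)

odd-∤ : ∀ q → ¬ 2 ∣ 1 + q * 2
odd-∤ q 2∣ with trans (sym ([m+kn]%n≡m%n 1 q 2)) (n∣m⇒m%n≡0 (1 + q * 2) 2 2∣)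
... | ()

lemma3p1 : ∀ (n : ℕ) → 1 ≤ n → (IsN (K n) ⇔ 2 ∣ n)
lemma3p1 n 1≤n with n divMod 2
... | result zero    0F refl = contradiction 1≤n λ ()
... | result (suc j) 0F refl =
  mk⇔ (λ _ → divides (suc j) refl)
      (λ _ → evenCliqueWins j (removeIsolated-HasSize₂₊ everything-HasSize))
... | result q       1F refl =
  mk⇔ (λ isN → contradiction (odd-start-loses q) (WinPos⇒¬LosePos isN))
      (λ 2∣ → contradiction 2∣ (odd-∤ q))
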